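{- Let $n\ge 3$ and let $H_n$ be the crown graph with $U=\{u_1,\dots,u_n\}$, $V=\{v_1,\dots,v_n\}$ and $u_iv_j\in E(H_n)$ iff $i\neq j$. Then $\operatorname{fp}(H_n)=2$ and $\operatorname{width}(\mathcal P_U)=\operatorname{width}(\mathcal P_V)=n$.
   Context: A bipartite graph is a Ferrers graph if it contains no induced copy of $2K_2$ (two disjoint edges with no other edges among their four endpoints). For a bipartite graph $G=(U,V,E)$, $\operatorname{fp}(G)$ is the minimum $k$ such that $E$ can be partitioned into $k$ sets $E_i$ with each spanning subgraph $(U,V,E_i)$ a Ferrers graph. $\operatorname{width}(\mathcal P_U)$ is the maximum number of pairwise inclusion-incomparable sets in the family of neighborhoods $\{N(u):u\in U\}$ (the width of the poset $u\preceq u'$ iff $N(u)\subseteq N(u')$); $\operatorname{width}(\mathcal P_V)$ is defined symmetrically. -}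

module Defs where

open import Data.Nat using (ℕ; _≤_)
open import Data.Fin using (Fin; _≟_)
open import Data.Bool using (Bool; true; not)
open import Data.Product using (Σ; ∃; _×_; _,_)
open import Data.Empty using (⊥)
open import Relation.Binary.PropositionalEquality using (_≡_; _≢_)
open import Relation.Nullary using (¬_)
open import Relation.Nullary.Decidable using (⌊_⌋)

record BipGraph : Set where
  constructor bip
  field
    m   : ℕ
    n   : ℕ
    adj : Fin m → Fin n → Bool
open BipGraph public

Edge : (G : BipGraph) → Fin (m G) → Fin (n G) → Set
Edge G u v = adj G u v ≡ true

-- A bipartite graph on parts Fin a, Fin b given by an edge relation E
-- is Ferrers iff it has no induced 2K2: there are no u, u', v, v' with
-- uv, u'v' ∈ E and uv', u'v ∉ E.
IsFerrersRel : {a b : ℕ} → (Fin a → Fin b → Set) → Set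
IsFerrersRel E = ∀ u u' v v' → E u v → E u' v' → ¬ E u v' → ¬ E u' v → ⊥

IsFerrers : BipGraph → Set
IsFerrers G = IsFerrersRel (Edge G)

-- A partition of E(G) into k (possibly empty) sets E_0..E_{k-1}, given by
-- assigning each edge a class in Fin k, such that every spanning subgraph
-- (U, V, E_i) is a Ferrers graph.
FerrersPartition : BipGraph → ℕ → Set
FerrersPartition G k =
  Σ ((u : Fin (m G)) → (v : Fin (n G)) → Edge G u v → Fin k) λ c →
    (i : Fin k) → IsFerrersRel (λ u v → Σ (Edge G u v) λ e → c u v e ≡ i)

FpIs : BipGraph → ℕ → Set
FpIs G k = FerrersPartition G k × (∀ j → FerrersPartition G j → k ≤ j)

NU⊆ : (G : BipGraph) → Fin (m G) → Fin (m G) → Set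
NU⊆ G u u' = ∀ v → Edge G u v → Edge G u' v

NV⊆ : (G : BipGraph) → Fin (n G) → Fin (n G) → Set
NV⊆ G v v' = ∀ u → Edge G u v → Edge G u v'

-- An antichain of size w in P_U: w elements (indexed by Fin w) whose
-- neighbourhoods are pairwise inclusion-incomparable (this forces the
-- elements to be distinct).
AntichainU : (G : BipGraph) → ℕ → Set
AntichainU G w = Σ (Fin w → Fin (m G)) λ f →
  ∀ i j → i ≢ j → ¬ NU⊆ G (f i) (f j)

AntichainV : (G : BipGraph) → ℕ → Set
AntichainV G w = Σ (Fin w → Fin (n G)) λ f →
  ∀ i j → i ≢ j → ¬ NV⊆ G (f i) (f j)

WidthUIs : BipGraph → ℕ → Set
WidthUIs G w = AntichainU G w × (∀ k → AntichainU G k → k ≤ w)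

WidthVIs : BipGraph → ℕ → Set
WidthVIs G w = AntichainV G w × (∀ k → AntichainV G k → k ≤ w)

crown : ℕ → BipGraph
crown n = bip n n (λ i j → not ⌊ i ≟ j ⌋)

{-# OPTIONS --safe #-}
-- The crown graph splits into the edges above and below the diagonal, and
-- each half is a threshold relation (i < j, resp. j < i), which has nested
-- neighbourhoods and hence no induced 2K2.  One class cannot suffice, since
-- u₀v₁, u₁v₀ is an induced 2K2.  For the widths, N(uᵢ) = V ∖ {vᵢ} are
-- pairwise incomparable, and no antichain can be larger than its ground set
-- because incomparable neighbourhoods force distinct vertices.
module Submission where

open import Defs
open import Data.Nat using (ℕ; _≤_; s≤s; z≤n)
import Data.Nat as ℕ using (_<_)
import Data.Nat.Properties as ℕₚ
open import Data.Fin using (Fin; zero; suc; toℕ; _≟_; _<_)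
open import Data.Fin.Properties using (_<?_; <-asym; <⇒≢; ≤∧≢⇒<; injective⇒≤)
open import Data.Bool.Properties using (T-≡)
open import Data.Product using (Σ; _×_; _,_; proj₁)
open import Data.Empty using (⊥-elim)
open import Function using (id; flip; _∘_)
open import Function.Bundles using (_⇔_; mk⇔; Equivalence)
open import Function.Definitions using (Injective)
open import Relation.Nullary using (¬_; yes; no)
open import Relation.Nullary.Decidable using (fromWitnessFalse; toWitnessFalse)
open import Relation.Binary.PropositionalEquality
  using (_≡_; _≢_; refl; subst; ≢-sym)

private
  variable
    a b j k : ℕ
    G : BipGraph

isFerrersRel-resp-⇔ : {E F : Fin a → Fin b → Set} →
  (∀ u v → E u v ⇔ F u v) → IsFerrersRel E → IsFerrersRel F
isFerrersRel-resp-⇔ E⇔F ferrers u u' v v' uv u'v' ¬uv' ¬u'v =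
  ferrers u u' v v' (from uv) (from u'v') (¬uv' ∘ to) (¬u'v ∘ to)
  where open module E⇔F {u} {v} = Equivalence (E⇔F u v)

isFerrersRel-flip : {E : Fin a → Fin b → Set} →
  IsFerrersRel E → IsFerrersRel (flip E)
isFerrersRel-flip ferrers v v' u u' uv u'v' ¬u'v ¬uv' =
  ferrers u u' v v' uv u'v' ¬uv' ¬u'v

<-isFerrersRel : (f : Fin a → ℕ) (g : Fin b → ℕ) →
  IsFerrersRel (λ u v → f u ℕ.< g v)
<-isFerrersRel f g u u' v v' uv u'v' ¬uv' ¬u'v = ℕₚ.<-irrefl refl (begin-strict
  f u   <⟨ uv ⟩
  g v   ≤⟨ ℕₚ.≮⇒≥ ¬u'v ⟩
  f u'  <⟨ u'v' ⟩
  g v'  ≤⟨ ℕₚ.≮⇒≥ ¬uv' ⟩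
  f u   ∎)
  where open ℕₚ.≤-Reasoning

partition-into-≤1⇒isFerrers : j ≤ 1 → FerrersPartition G j → IsFerrers G
partition-into-≤1⇒isFerrers j≤1 (c , ferrers) u u' v v' uv u'v' ¬uv' ¬u'v =
  ferrers (c u v uv) u u' v v'
    (uv , refl) (u'v' , subsingleton j≤1 _ _) (¬uv' ∘ proj₁) (¬u'v ∘ proj₁)
  where
  subsingleton : j ≤ 1 → (i i′ : Fin j) → i ≡ i′
  subsingleton (s≤s z≤n) zero zero = refl

¬isFerrers⇒2≤parts : ¬ IsFerrers G → FerrersPartition G j → 2 ≤ j
¬isFerrers⇒2≤parts ¬ferrers partition =
  ℕₚ.≰⇒> (λ j≤1 → ¬ferrers (partition-into-≤1⇒isFerrers j≤1 partition))

antichainU⇒≤m : ∀ {w} → AntichainU G w → w ≤ m G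
antichainU⇒≤m {G} (f , incomparable) = injective⇒≤ injective
  where
  injective : Injective _≡_ _≡_ f
  injective {i} {j} fi≡fj with i ≟ j
  ... | yes i≡j = i≡j
  ... | no i≢j  = ⊥-elim (incomparable i j i≢j
                    (λ v → subst (λ u → Edge G u v) fi≡fj))

antichainV⇒≤n : ∀ {w} → AntichainV G w → w ≤ n G
antichainV⇒≤n {G} (f , incomparable) = injective⇒≤ injective
  where
  injective : Injective _≡_ _≡_ f
  injective {i} {j} fi≡fj with i ≟ j
  ... | yes i≡j = i≡j
  ... | no i≢j  = ⊥-elim (incomparable i j i≢j
                    (λ u → subst (Edge G u) fi≡fj))

crown-edge⇒≢ : {u v : Fin k} → Edge (crown k) u v → u ≢ v
crown-edge⇒≢ = toWitnessFalse ∘ Equivalence.from T-≡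

≢⇒crown-edge : {u v : Fin k} → u ≢ v → Edge (crown k) u v
≢⇒crown-edge = Equivalence.to T-≡ ∘ fromWitnessFalse

crown-¬isFerrers : 2 ≤ k → ¬ IsFerrers (crown k)
crown-¬isFerrers (s≤s (s≤s _)) ferrers =
  ferrers zero (suc zero) (suc zero) zero refl refl (λ ()) (λ ())

triangle : Fin k → Fin k → Fin 2
triangle u v with u <? v
... | yes _ = zero
... | no _  = suc zero

TriangleClass : Fin 2 → Fin k → Fin k → Set
TriangleClass {k} i u v = Σ (Edge (crown k) u v) λ _ → triangle u v ≡ i

<⇔upper-triangle : {u v : Fin k} → u < v ⇔ TriangleClass zero u v
<⇔upper-triangle {u = u} {v} = mk⇔ to from
  where
  to : u < v → TriangleClass zero u v
  to u<v with u <? v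
  ... | yes _   = ≢⇒crown-edge (<⇒≢ u<v) , refl
  ... | no u≮v  = ⊥-elim (u≮v u<v)

  from : TriangleClass zero u v → u < v
  from (_ , upper) with u <? v | upper
  ... | yes u<v | _ = u<v
  ... | no _    | ()

>⇔lower-triangle : {u v : Fin k} → v < u ⇔ TriangleClass (suc zero) u v
>⇔lower-triangle {u = u} {v} = mk⇔ to from
  where
  to : v < u → TriangleClass (suc zero) u v
  to v<u with u <? v
  ... | yes u<v = ⊥-elim (<-asym u<v v<u)
  ... | no _    = ≢⇒crown-edge (≢-sym (<⇒≢ v<u)) , refl

  from : TriangleClass (suc zero) u v → v < u
  from (uv , lower) with u <? v | lower
  ... | yes _   | ()
  ... | no u≮v  | _ = ≤∧≢⇒< (ℕₚ.≮⇒≥ u≮v) (≢-sym (crown-edge⇒≢ uv))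

triangle-partition : FerrersPartition (crown k) 2
triangle-partition = (λ u v _ → triangle u v) , λ where
  zero       → isFerrersRel-resp-⇔ (λ _ _ → <⇔upper-triangle) (<-isFerrersRel toℕ toℕ)
  (suc zero) → isFerrersRel-resp-⇔ (λ _ _ → >⇔lower-triangle)
                 (isFerrersRel-flip (<-isFerrersRel toℕ toℕ))

crown-antichainU : AntichainU (crown k) k
crown-antichainU = id , λ i j i≢j Nᵢ⊆Nⱼ →
  crown-edge⇒≢ (Nᵢ⊆Nⱼ j (≢⇒crown-edge i≢j)) refl

crown-antichainV : AntichainV (crown k) k
crown-antichainV = id , λ i j i≢j Nᵢ⊆Nⱼ →
  crown-edge⇒≢ (Nᵢ⊆Nⱼ j (≢⇒crown-edge (≢-sym i≢j))) refl

theorem6p4 : (n : ℕ) → 3 ≤ n →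
    FpIs (crown n) 2 × WidthUIs (crown n) n × WidthVIs (crown n) n
theorem6p4 n 3≤n =
  (triangle-partition , λ _ → ¬isFerrers⇒2≤parts (crown-¬isFerrers (ℕₚ.<⇒≤ 3≤n))) ,
  (crown-antichainU , λ _ → antichainU⇒≤m {crown n}) ,
  (crown-antichainV , λ _ → antichainV⇒≤n {crown n})
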